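{- Let $\mathfrak{M}=(W,1,\curlywedge,V)$ and $\mathfrak{M}'=(W',1',\curlywedge',V')$ be L$_1$-models, $T$ a meet-simulation from $\mathfrak{M}$ to $\mathfrak{M}'$, $(w_1,w_2,w')\in T$ and $\phi\in\mathcal{L}$. If $\mathfrak{M},w_1\Vdash\phi$ and $\mathfrak{M},w_2\Vdash\phi$, then $\mathfrak{M}',w'\Vdash\phi$.
   Context: $\mathcal{L}$ is generated by $\phi ::= p\mid\top\mid\bot\mid\phi\wedge\phi\mid\phi\vee\phi$, $p$ in a fixed set $\mathrm{Prop}$. A meet-semilattice $(W,1,\curlywedge)$ is a poset in which every finite subset has a meet; $\curlywedge$ binary meet, $1$ top, $w\preccurlyeq v$ iff $w\curlywedge v=w$. A filter is a $\preccurlyeq$-upward closed subset closed under finite meets. An L$_1$-model $(W,1,\curlywedge,V)$ is a meet-semilattice with $V(p)$ a filter for each $p$. Satisfaction: $w\Vdash p$ iff $w\in V(p)$; $w\Vdash\top$ always; $w\Vdash\bot$ iff $w=1$; $\wedge$ classical; $w\Vdash\phi_1\vee\phi_2$ iff there are $u,v$ with $u\curlywedge v\preccurlyeq w$, $u\Vdash\phi_1$, $v\Vdash\phi_2$. A meet-simulation from $\mathfrak{M}$ to $\mathfrak{M}'$ is a relation $T\subseteq(W\times W)\times W'$ (written as triples) such that for all $(w_1,w_2,w')\in T$: (M1) if $w_1\in V(p)$ and $w_2\in V(p)$ then $w'\in V'(p)$, for all $p\in\mathrm{Prop}$; (M2) if $w_1=w_2=1$ then $w'=1'$; (M3) if $u_1,v_1,u_2,v_2\in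 W$ satisfy $u_1\curlywedge v_1\preccurlyeq w_1$ and $u_2\curlywedge v_2\preccurlyeq w_2$, then there exist $v',u'\in W'$ with $(u_1,u_2,u')\in T$, $(v_1,v_2,v')\in T$ and $v'\curlywedge'u'\preccurlyeq' w'$. -}

module Defs where

open import Level using (Level; _⊔_; suc)
open import Relation.Binary.PropositionalEquality using (_≡_)
open import Data.Product using (Σ; _×_; ∃; ∃-syntax)
open import Data.Unit.Polymorphic using (⊤)

data Form {p : Level} (Prop : Set p) : Set p where
  var  : Prop → Form Prop
  ⊤'   : Form Prop
  ⊥'   : Form Prop
  _∧'_ : Form Prop → Form Prop → Form Prop
  _∨'_ : Form Prop → Form Prop → Form Prop

-- A bounded meet-semilattice (W, 1, ⋏) with propositional equality:
-- binary meet that is idempotent, commutative, associative, with top 1.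
-- (Every finite subset has a meet iff these laws hold.)
record MeetSL (w : Level) : Set (suc w) where
  field
    W     : Set w
    one   : W
    _⋏_   : W → W → W
    idem  : ∀ x → x ⋏ x ≡ x
    comm  : ∀ x y → x ⋏ y ≡ y ⋏ x
    assoc : ∀ x y z → (x ⋏ y) ⋏ z ≡ x ⋏ (y ⋏ z)
    topʳ  : ∀ x → x ⋏ one ≡ x

  _≼_ : W → W → Set w
  x ≼ y = x ⋏ y ≡ x

record IsFilter {w : Level} (S : MeetSL w) (F : MeetSL.W S → Set w) : Set w where
  open MeetSL S
  field
    up      : ∀ {x y} → x ≼ y → F x → F y
    has-one : F one
    meet    : ∀ {x y} → F x → F y → F (x ⋏ y)

record L1Model {p : Level} (Prop : Set p) (w : Level) : Set (suc w ⊔ p) where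
  field
    sl       : MeetSL w
  open MeetSL sl public
  field
    V        : Prop → W → Set w
    V-filter : ∀ q → IsFilter sl (V q)

module _ {p w : Level} {Prop : Set p} (M : L1Model Prop w) where
  open L1Model M

  _⊩_ : W → Form Prop → Set w
  x ⊩ var q    = V q x
  x ⊩ ⊤'       = ⊤
  x ⊩ ⊥'       = x ≡ one
  x ⊩ (φ ∧' ψ) = (x ⊩ φ) × (x ⊩ ψ)
  x ⊩ (φ ∨' ψ) = Σ W λ u → Σ W λ v → ((u ⋏ v) ≼ x) × (u ⊩ φ) × (v ⊩ ψ)

record IsMeetSimulation {p w w' t : Level} {Prop : Set p}
    (M : L1Model Prop w) (M' : L1Model Prop w')
    (T : L1Model.W M → L1Model.W M → L1Model.W M' → Set t)
    : Set (p ⊔ w ⊔ w' ⊔ t) where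
  module M  = L1Model M
  module M' = L1Model M'
  field
    M1 : ∀ {w₁ w₂ w'} → T w₁ w₂ w' → ∀ q → M.V q w₁ → M.V q w₂ → M'.V q w'
    M2 : ∀ {w₁ w₂ w'} → T w₁ w₂ w' → w₁ ≡ M.one → w₂ ≡ M.one → w' ≡ M'.one
    M3 : ∀ {w₁ w₂ w'} → T w₁ w₂ w' → ∀ u₁ v₁ u₂ v₂ →
         M._≼_ (M._⋏_ u₁ v₁) w₁ → M._≼_ (M._⋏_ u₂ v₂) w₂ →
         Σ M'.W λ v' → Σ M'.W λ u' →
           T u₁ u₂ u' × T v₁ v₂ v' × M'._≼_ (M'._⋏_ v' u') w'

-- The only non-local case is ∨: the two witness pairs for w₁ and w₂
-- are combined pointwise by (M3), and the induction hypothesis applies to the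
-- resulting triples, which again lie in T.
module Submission where

open import Defs
open import Data.Product using (_,_)
open import Data.Unit.Polymorphic using (tt)
open import Relation.Binary.PropositionalEquality using (_≡_; subst)

module _ {w} (S : MeetSL w) where
  open MeetSL S

  ⋏-comm-≼ : ∀ {x y z} → (x ⋏ y) ≼ z → (y ⋏ x) ≼ z
  ⋏-comm-≼ {x} {y} {z} = subst (λ m → m ⋏ z ≡ m) (comm x y)

module _ {p w w' t} {Prop : Set p}
    {M : L1Model Prop w} {M' : L1Model Prop w'}
    {T : L1Model.W M → L1Model.W M → L1Model.W M' → Set t}
    (sim : IsMeetSimulation M M' T) where

  open IsMeetSimulation sim

  meetSimulation-preserves-⊩ : ∀ {w₁ w₂ w'} → T w₁ w₂ w' → (φ : Form Prop) →
                               _⊩_ M w₁ φ → _⊩_ M w₂ φ → _⊩_ M' w' φ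
  meetSimulation-preserves-⊩ tr (var q)  h₁ h₂ = M1 tr q h₁ h₂
  meetSimulation-preserves-⊩ tr ⊤'       h₁ h₂ = tt
  meetSimulation-preserves-⊩ tr ⊥'       h₁ h₂ = M2 tr h₁ h₂
  meetSimulation-preserves-⊩ tr (φ ∧' ψ) (φ₁ , ψ₁) (φ₂ , ψ₂) =
    meetSimulation-preserves-⊩ tr φ φ₁ φ₂ , meetSimulation-preserves-⊩ tr ψ ψ₁ ψ₂
  meetSimulation-preserves-⊩ tr (φ ∨' ψ) (u₁ , v₁ , le₁ , φu₁ , ψv₁) (u₂ , v₂ , le₂ , φu₂ , ψv₂)
    with M3 tr u₁ v₁ u₂ v₂ le₁ le₂
  ... | v' , u' , tu , tv , le =
    u' , v' , ⋏-comm-≼ (L1Model.sl M') le ,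
    meetSimulation-preserves-⊩ tu φ φu₁ φu₂ , meetSimulation-preserves-⊩ tv ψ ψv₁ ψv₂

proposition7p7 : ∀ {p w w' t} {Prop : Set p}
    (M : L1Model Prop w) (M' : L1Model Prop w')
    (T : L1Model.W M → L1Model.W M → L1Model.W M' → Set t) →
    IsMeetSimulation M M' T →
    ∀ {w₁ w₂ : L1Model.W M} {v' : L1Model.W M'} → T w₁ w₂ v' →
    (φ : Form Prop) → _⊩_ M w₁ φ → _⊩_ M w₂ φ → _⊩_ M' v' φ
proposition7p7 M M' T sim = meetSimulation-preserves-⊩ sim
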